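{- For each choice of the sign $\pm$, the Diophantine equation $x^3\pm y^3=a^6-b^6$ has infinitely many nontrivial solutions $(x,y,a,b)$ in positive integers.
   Context: A quadruple $(x,y,a,b)$ of integers is called a nontrivial solution of an equation $x^3\pm y^3=a^k\pm b^k$ (signs fixed) if $\gcd(x,y,a,b)=1$ and no partial sum in the expression $x^3\pm y^3-(a^k\pm b^k)$ vanishes. -}

module Defs where

open import Data.Bool using (Bool; true; false; if_then_else_)
open import Data.Integer using (ℤ; +_; _+_; _*_; -_; _-_; _^_; ∣_∣; _<_)
open import Data.Nat using (ℕ)
open import Data.Nat.GCD using (gcd)
open import Data.Product using (_×_; Σ; ∃; ∃-syntax)
open import Data.Empty using (⊥)
open import Data.Unit using (⊤)
open import Relation.Binary.PropositionalEquality using (_≡_; _≢_)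
open import Relation.Nullary using (¬_)

sgn : Bool → ℤ
sgn true  = + 1
sgn false = - (+ 1)

gcd4 : ℤ → ℤ → ℤ → ℤ → ℕ
gcd4 x y a b = gcd (gcd ∣ x ∣ ∣ y ∣) (gcd ∣ a ∣ ∣ b ∣)

sel : Bool → ℤ → ℤ
sel true  t = t
sel false _ = + 0

subsetSum : Bool → Bool → Bool → Bool → ℤ → ℤ → ℤ → ℤ → ℤ
subsetSum e₁ e₂ e₃ e₄ t₁ t₂ t₃ t₄ = sel e₁ t₁ + sel e₂ t₂ + sel e₃ t₃ + sel e₄ t₄

NonemptyProper : Bool → Bool → Bool → Bool → Set
NonemptyProper false false false false = ⊥
NonemptyProper true  true  true  true  = ⊥
NonemptyProper _     _     _     _     = ⊤

NoVanishingPartialSum : ℤ → ℤ → ℤ → ℤ → Set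
NoVanishingPartialSum t₁ t₂ t₃ t₄ =
  ∀ e₁ e₂ e₃ e₄ → NonemptyProper e₁ e₂ e₃ e₄ → subsetSum e₁ e₂ e₃ e₄ t₁ t₂ t₃ t₄ ≢ + 0

-- (x,y,a,b) is a nontrivial solution of x³ ± y³ = a⁶ - b⁶ (sign s)
-- The expression x³ ± y³ - (a⁶ - b⁶) has terms x³, ±y³, -a⁶, b⁶.
NontrivialSolution : Bool → ℤ → ℤ → ℤ → ℤ → Set
NontrivialSolution s x y a b =
  (x ^ 3 + sgn s * y ^ 3 ≡ a ^ 6 - b ^ 6)
  × gcd4 x y a b ≡ 1
  × NoVanishingPartialSum (x ^ 3) (sgn s * y ^ 3) (- (a ^ 6)) (b ^ 6)

{-# OPTIONS --safe #-}
-- Take b = 1. Ramanujan's identity (9u⁴)³ + (3u − 9u⁴)³ + (1 − 9u³)³ = 1, read at u and at −u,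
-- gives for every u ≥ 1 positive solutions of x³ + y³ = a⁶ − 1 and of x³ − y³ = a⁶ − 1 that grow
-- with u. With b = 1 the gcd condition is automatic, and since the four terms x³, ±y³, −a⁶, 1
-- sum to zero, a vanishing partial sum would force a single term, or a term plus 1, to vanish;
-- this is excluded because x³ > 0, a⁶ > 1, and ±y³ is either positive or below −1.
module Submission where

open import Data.Bool using (Bool; true; false; not)
import Data.Nat as ℕ
open import Data.Nat using (ℕ; zero; suc; s≤s; z≤n; z<s)
open import Data.Nat.GCD using (gcd; gcd-zeroʳ)
import Data.Nat.Properties as ℕ
open import Data.Product using (∃-syntax; _×_; _,_)
open import Data.Unit using (tt)
open import Function using (_∘_)
open import Relation.Binary.PropositionalEquality
  using (_≡_; _≢_; refl; sym; trans; cong; cong₂; module ≡-Reasoning)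

open import Defs

-- With u = t + 1: x⁺ = 9u³ − 1, y⁺ = 9u⁴ − 3u, x⁻ = 9u⁴ + 3u, y⁻ = 9u³ + 1 and a = 3u²,
-- so that a⁶ = (9u⁴)³.
module RamanujanFamilies where
  open import Data.Nat using (_+_; _*_; _^_; _<_)
  open import Data.Nat.Solver using (module +-*-Solver)
  open +-*-Solver

  x⁺ y⁺ x⁻ y⁻ a : ℕ → ℕ
  x⁺ t = 8 + 27 * t + 27 * t ^ 2 + 9 * t ^ 3
  y⁺ t = 6 + 33 * t + 54 * t ^ 2 + 36 * t ^ 3 + 9 * t ^ 4
  x⁻ t = 12 + 39 * t + 54 * t ^ 2 + 36 * t ^ 3 + 9 * t ^ 4
  y⁻ t = 10 + 27 * t + 27 * t ^ 2 + 9 * t ^ 3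
  a  t = 3 + 6 * t + 3 * t ^ 2

  ramanujan⁺ : ∀ t → x⁺ t ^ 3 + y⁺ t ^ 3 + 1 ≡ a t ^ 6
  ramanujan⁺ = solve 1 (λ t →
      (con 8 :+ con 27 :* t :+ con 27 :* t :^ 2 :+ con 9 :* t :^ 3) :^ 3
    :+ (con 6 :+ con 33 :* t :+ con 54 :* t :^ 2 :+ con 36 :* t :^ 3 :+ con 9 :* t :^ 4) :^ 3
    :+ con 1
    := (con 3 :+ con 6 :* t :+ con 3 :* t :^ 2) :^ 6) refl

  ramanujan⁻ : ∀ t → x⁻ t ^ 3 + 1 ≡ y⁻ t ^ 3 + a t ^ 6
  ramanujan⁻ = solve 1 (λ t →
      (con 12 :+ con 39 :* t :+ con 54 :* t :^ 2 :+ con 36 :* t :^ 3 :+ con 9 :* t :^ 4) :^ 3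
    :+ con 1
    := (con 10 :+ con 27 :* t :+ con 27 :* t :^ 2 :+ con 9 :* t :^ 3) :^ 3
    :+ (con 3 :+ con 6 :* t :+ con 3 :* t :^ 2) :^ 6) refl

  t<a : ∀ t → t < a t
  t<a t = s≤s (ℕ.≤-trans (ℕ.m≤n*m t 6) (ℕ.≤-trans (ℕ.m≤n+m (6 * t) 2) (ℕ.m≤m+n (2 + 6 * t) _)))

open RamanujanFamilies

-- Imported only here: RamanujanFamilies uses the ℕ operators, whose names these would clash with.
open import Data.Integer
  using (ℤ; +_; -[1+_]; _+_; _-_; -_; _*_; _^_; _<_; ∣_∣; +<+; -<+)
open import Data.Integer.Properties using (+-identityˡ; +-identityʳ; *-identityˡ; pos-*)
open import Data.Integer.Tactic.RingSolver using (solve-∀)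

sel-+-not : ∀ e t → sel e t + sel (not e) t ≡ t
sel-+-not true  t = +-identityʳ t
sel-+-not false t = +-identityˡ t

subsetSum-+-not : ∀ e₁ e₂ e₃ e₄ t₁ t₂ t₃ t₄ →
  subsetSum e₁ e₂ e₃ e₄ t₁ t₂ t₃ t₄ + subsetSum (not e₁) (not e₂) (not e₃) (not e₄) t₁ t₂ t₃ t₄
    ≡ t₁ + t₂ + t₃ + t₄
subsetSum-+-not e₁ e₂ e₃ e₄ t₁ t₂ t₃ t₄ =
  trans (interchange (sel e₁ t₁) (sel e₂ t₂) (sel e₃ t₃) (sel e₄ t₄)
                     (sel (not e₁) t₁) (sel (not e₂) t₂) (sel (not e₃) t₃) (sel (not e₄) t₄))
        (cong₂ _+_ (cong₂ _+_ (cong₂ _+_ (sel-+-not e₁ t₁) (sel-+-not e₂ t₂)) (sel-+-not e₃ t₃))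
                   (sel-+-not e₄ t₄))
  where
  interchange : ∀ a b c d a′ b′ c′ d′ →
    (a + b + c + d) + (a′ + b′ + c′ + d′) ≡ (a + a′) + (b + b′) + (c + c′) + (d + d′)
  interchange = solve-∀

nonemptyProper-not : ∀ e₁ e₂ e₃ → NonemptyProper e₁ e₂ e₃ false →
  NonemptyProper (not e₁) (not e₂) (not e₃) true
nonemptyProper-not false false false ()
nonemptyProper-not false false true  _ = tt
nonemptyProper-not false true  false _ = tt
nonemptyProper-not false true  true  _ = tt
nonemptyProper-not true  false false _ = tt
nonemptyProper-not true  false true  _ = tt
nonemptyProper-not true  true  false _ = tt
nonemptyProper-not true  true  true  _ = tt

≢0-by : ∀ {i j : ℤ} → i ≡ j → j ≢ + 0 → i ≢ + 0
≢0-by i≡j j≢0 = j≢0 ∘ trans (sym i≡j)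

-- A partial sum and its complement add up to the total 0, so only subsets containing t₄ need
-- checking; their sums are t₄, t₁ + t₄, t₂ + t₄, t₃ + t₄, −t₁, −t₂ and −t₃.
zeroSum⇒noVanishingPartialSum : ∀ {t₁ t₂ t₃ t₄} → t₁ + t₂ + t₃ + t₄ ≡ + 0 →
  t₁ ≢ + 0 → t₂ ≢ + 0 → t₃ ≢ + 0 → t₄ ≢ + 0 →
  t₁ + t₄ ≢ + 0 → t₂ + t₄ ≢ + 0 → t₃ + t₄ ≢ + 0 →
  NoVanishingPartialSum t₁ t₂ t₃ t₄
zeroSum⇒noVanishingPartialSum {t₁} {t₂} {t₃} {t₄}
  total≡0 t₁≢0 t₂≢0 t₃≢0 t₄≢0 t₁₄≢0 t₂₄≢0 t₃₄≢0 = partial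
  where
  complement-≡0 : ∀ e₁ e₂ e₃ e₄ → subsetSum e₁ e₂ e₃ e₄ t₁ t₂ t₃ t₄ ≡ + 0 →
    subsetSum (not e₁) (not e₂) (not e₃) (not e₄) t₁ t₂ t₃ t₄ ≡ + 0
  complement-≡0 e₁ e₂ e₃ e₄ sum≡0 = begin
    s′          ≡⟨ +-identityˡ s′ ⟨
    + 0 + s′    ≡⟨ cong (_+ s′) sum≡0 ⟨
    s + s′      ≡⟨ subsetSum-+-not e₁ e₂ e₃ e₄ t₁ t₂ t₃ t₄ ⟩
    t₁ + t₂ + t₃ + t₄ ≡⟨ total≡0 ⟩
    + 0         ∎
    where
    open ≡-Reasoning
    s  = subsetSum e₁ e₂ e₃ e₄ t₁ t₂ t₃ t₄
    s′ = subsetSum (not e₁) (not e₂) (not e₃) (not e₄) t₁ t₂ t₃ t₄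

  with-t₄ : ∀ e₁ e₂ e₃ → NonemptyProper e₁ e₂ e₃ true → subsetSum e₁ e₂ e₃ true t₁ t₂ t₃ t₄ ≢ + 0
  with-t₄ false false false _ = ≢0-by (+-identityˡ t₄) t₄≢0
  with-t₄ true  false false _ = ≢0-by (cong (_+ t₄) (trans (+-identityʳ _) (+-identityʳ t₁))) t₁₄≢0
  with-t₄ false true  false _ = ≢0-by (cong (_+ t₄) (trans (+-identityʳ _) (+-identityˡ t₂))) t₂₄≢0
  with-t₄ false false true  _ = ≢0-by (cong (_+ t₄) (+-identityˡ t₃)) t₃₄≢0
  with-t₄ true  true  false _ =
    ≢0-by (trans (+-identityʳ _) (+-identityˡ t₃)) t₃≢0 ∘ complement-≡0 true true false true
  with-t₄ true  false true  _ =
    ≢0-by (trans (+-identityʳ _) (trans (+-identityʳ _) (+-identityˡ t₂))) t₂≢0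
      ∘ complement-≡0 true false true true
  with-t₄ false true  true  _ =
    ≢0-by (trans (+-identityʳ _) (trans (+-identityʳ _) (+-identityʳ t₁))) t₁≢0
      ∘ complement-≡0 false true true true
  with-t₄ true  true  true  ()

  partial : NoVanishingPartialSum t₁ t₂ t₃ t₄
  partial e₁ e₂ e₃ true  p = with-t₄ e₁ e₂ e₃ p
  partial e₁ e₂ e₃ false p =
    with-t₄ (not e₁) (not e₂) (not e₃) (nonemptyProper-not e₁ e₂ e₃ p)
      ∘ complement-≡0 e₁ e₂ e₃ false

gcd4[x,y,a,1]≡1 : ∀ x y a → gcd4 x y a (+ 1) ≡ 1
gcd4[x,y,a,1]≡1 x y a =
  trans (cong (gcd (gcd ∣ x ∣ ∣ y ∣)) (gcd-zeroʳ ∣ a ∣)) (gcd-zeroʳ (gcd ∣ x ∣ ∣ y ∣))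

nontrivialSolution-b≡1 : ∀ s x y a → x ^ 3 + sgn s * y ^ 3 + + 1 ≡ a ^ 6 →
  x ^ 3 ≢ + 0 → sgn s * y ^ 3 ≢ + 0 → - (a ^ 6) ≢ + 0 →
  x ^ 3 + + 1 ≢ + 0 → sgn s * y ^ 3 + + 1 ≢ + 0 → - (a ^ 6) + + 1 ≢ + 0 →
  NontrivialSolution s x y a (+ 1)
nontrivialSolution-b≡1 s x y a eq X≢0 Y≢0 A≢0 X+1≢0 Y+1≢0 A+1≢0 =
  equation , gcd4[x,y,a,1]≡1 x y a ,
  zeroSum⇒noVanishingPartialSum zeroSum X≢0 Y≢0 A≢0 (λ ()) X+1≢0 Y+1≢0 A+1≢0
  where
  i≡i+1-1 : ∀ i → i ≡ i + + 1 - + 1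
  i≡i+1-1 = solve-∀

  i-[i+1]+1≡0 : ∀ i → i + - (i + + 1) + + 1 ≡ + 0
  i-[i+1]+1≡0 = solve-∀

  equation : x ^ 3 + sgn s * y ^ 3 ≡ a ^ 6 - + 1
  equation = trans (i≡i+1-1 (x ^ 3 + sgn s * y ^ 3)) (cong (_- + 1) eq)

  zeroSum : x ^ 3 + sgn s * y ^ 3 + - (a ^ 6) + + 1 ≡ + 0
  zeroSum = trans (cong (λ A → x ^ 3 + sgn s * y ^ 3 + - A + + 1) (sym eq))
                  (i-[i+1]+1≡0 (x ^ 3 + sgn s * y ^ 3))

pos-^ : ∀ m n → + (m ℕ.^ n) ≡ (+ m) ^ n
pos-^ m zero    = refl
pos-^ m (suc n) = trans (pos-* m (m ℕ.^ n)) (cong (+ m *_) (pos-^ m n))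

-- Once x, y and a are successors, each side condition of nontrivialSolution-b≡1 evaluates to
-- an equation between distinct constructors.
nontrivialSolution⁺ : ∀ x y a → x ℕ.^ 3 ℕ.+ y ℕ.^ 3 ℕ.+ 1 ≡ a ℕ.^ 6 →
  1 ℕ.≤ x → 1 ℕ.≤ y → 2 ℕ.≤ a → NontrivialSolution true (+ x) (+ y) (+ a) (+ 1)
nontrivialSolution⁺ x y a eq (s≤s z≤n) (s≤s z≤n) (s≤s (s≤s z≤n)) =
  nontrivialSolution-b≡1 true (+ x) (+ y) (+ a) equation (λ ()) (λ ()) (λ ()) (λ ()) (λ ()) (λ ())
  where
  open ≡-Reasoning
  equation : (+ x) ^ 3 + sgn true * (+ y) ^ 3 + + 1 ≡ (+ a) ^ 6
  equation = begin
    (+ x) ^ 3 + + 1 * (+ y) ^ 3 + + 1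
      ≡⟨ cong (λ i → (+ x) ^ 3 + i + + 1) (*-identityˡ ((+ y) ^ 3)) ⟩
    (+ x) ^ 3 + (+ y) ^ 3 + + 1
      ≡⟨ cong₂ (λ i j → i + j + + 1) (pos-^ x 3) (pos-^ y 3) ⟨
    + (x ℕ.^ 3 ℕ.+ y ℕ.^ 3 ℕ.+ 1)
      ≡⟨ cong +_ eq ⟩
    + (a ℕ.^ 6)
      ≡⟨ pos-^ a 6 ⟩
    (+ a) ^ 6
      ∎

nontrivialSolution⁻ : ∀ x y a → x ℕ.^ 3 ℕ.+ 1 ≡ y ℕ.^ 3 ℕ.+ a ℕ.^ 6 →
  1 ℕ.≤ x → 2 ℕ.≤ y → 2 ℕ.≤ a → NontrivialSolution false (+ x) (+ y) (+ a) (+ 1)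
nontrivialSolution⁻ x y a eq (s≤s z≤n) (s≤s (s≤s z≤n)) (s≤s (s≤s z≤n)) =
  nontrivialSolution-b≡1 false (+ x) (+ y) (+ a) equation (λ ()) (λ ()) (λ ()) (λ ()) (λ ()) (λ ())
  where
  open ≡-Reasoning
  X = x ℕ.^ 3
  Y = y ℕ.^ 3
  A = a ℕ.^ 6

  i-j+1≡[i+1]-j : ∀ i j → i + - + 1 * j + + 1 ≡ i + + 1 - j
  i-j+1≡[i+1]-j = solve-∀

  j+k-j≡k : ∀ j k → j + k - j ≡ k
  j+k-j≡k = solve-∀

  equation : (+ x) ^ 3 + sgn false * (+ y) ^ 3 + + 1 ≡ (+ a) ^ 6
  equation = begin
    (+ x) ^ 3 + - + 1 * (+ y) ^ 3 + + 1
      ≡⟨ cong₂ (λ i j → i + - + 1 * j + + 1) (pos-^ x 3) (pos-^ y 3) ⟨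
    + X + - + 1 * + Y + + 1
      ≡⟨ i-j+1≡[i+1]-j (+ X) (+ Y) ⟩
    + (X ℕ.+ 1) - + Y
      ≡⟨ cong (λ n → + n - + Y) eq ⟩
    + (Y ℕ.+ A) - + Y
      ≡⟨ j+k-j≡k (+ Y) (+ A) ⟩
    + A
      ≡⟨ pos-^ a 6 ⟩
    (+ a) ^ 6
      ∎

∣i∣<m⇒i<+m : ∀ {i m} → ∣ i ∣ ℕ.< m → i < + m
∣i∣<m⇒i<+m {+ _}      ∣i∣<m = +<+ ∣i∣<m
∣i∣<m⇒i<+m { -[1+ _ ]} _     = -<+

N<x+y+a+1 : ∀ N x y → N < + x + + y + + a ∣ N ∣ + + 1
N<x+y+a+1 N x y = ∣i∣<m⇒i<+m
  (ℕ.<-≤-trans (t<a ∣ N ∣) (ℕ.≤-trans (ℕ.m≤n+m (a ∣ N ∣) (x ℕ.+ y)) (ℕ.m≤m+n _ 1)))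

mainTheorem4 : (s : Bool) → (N : ℤ) →
    ∃[ x ] ∃[ y ] ∃[ a ] ∃[ b ]
    (+ 0 < x × + 0 < y × + 0 < a × + 0 < b
    × N < x + y + a + b
    × NontrivialSolution s x y a b)
mainTheorem4 true N =
  + x⁺ t , + y⁺ t , + a t , + 1 , +<+ z<s , +<+ z<s , +<+ z<s , +<+ z<s ,
  N<x+y+a+1 N (x⁺ t) (y⁺ t) ,
  nontrivialSolution⁺ (x⁺ t) (y⁺ t) (a t) (ramanujan⁺ t) (s≤s z≤n) (s≤s z≤n) (s≤s (s≤s z≤n))
  where t = ∣ N ∣
mainTheorem4 false N =
  + x⁻ t , + y⁻ t , + a t , + 1 , +<+ z<s , +<+ z<s , +<+ z<s , +<+ z<s ,
  N<x+y+a+1 N (x⁻ t) (y⁻ t) ,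
  nontrivialSolution⁻ (x⁻ t) (y⁻ t) (a t) (ramanujan⁻ t) (s≤s z≤n) (s≤s (s≤s z≤n)) (s≤s (s≤s z≤n))
  where t = ∣ N ∣
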